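{- Let $G$ be the graph on vertex set $\{1,\ldots,16\}$ with edges $\{1,2\},\{1,3\}$, $\{2j,2j+1\}$ for $j=1,\ldots,7$, $\{2j,2j+2\}$ and $\{2j+1,2j+3\}$ for $j=1,\ldots,6$, and $\{14,16\},\{15,16\}$ (a ladder with rungs $\{2,3\},\{4,5\},\ldots,\{14,15\}$, capped at each end by a triangle). Then the bond lattice $L(G)$ is not isomorphic to the core of any upho lattice.
   Context: For a connected simple graph $G$ on vertex set $[n]$, a set partition $\pi$ of $[n]$ is $G$-connected if the induced subgraph of $G$ on each block of $\pi$ is connected; the bond lattice $L(G)$ is the set of $G$-connected partitions ordered by refinement ($\pi\le\pi'$ iff every block of $\pi$ is contained in a block of $\pi'$). A poset $\mathcal{P}$ is finite type $\mathbb{N}$-graded if it has a minimum $\hat0$, a rank function $\rho$ with $\rho(\hat0)=0$ such that every maximal chain has the form $\hat0=x_0\lessdot x_1\lessdot\cdots$ with $\rho(x_i)=i$, and finitely many elements of each rank. An upho lattice is a finite type $\mathbb{N}$-graded lattice $\mathcal{L}$ with at least two elements such that for every $p\in\mathcal{L}$ the principal filter $\{q\ge p\}$ is isomorphic to $\mathcal{L}$. Its core is the interval $[\hat0,s_1\vee\cdots\vee s_r]$ with $s_1,\ldots,s_r$ the atoms of $\mathcal{L}$. -}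

module Defs where

open import Data.Nat using (ℕ; zero; suc; _<_)
open import Data.Fin using (Fin; toℕ)
open import Data.Vec using (Vec; lookup)
open import Data.List using (List; []; _∷_)
open import Data.List.Membership.Propositional using (_∈_)
open import Data.Product using (Σ; ∃; ∃₂; _×_; _,_; proj₁; proj₂)
open import Data.Sum using (_⊎_)
open import Relation.Nullary using (¬_)
open import Relation.Binary.PropositionalEquality using (_≡_; _≢_)
open import Relation.Binary.Lattice.Structures using (IsLattice)

record RawPoset : Set₁ where
  field
    Carrier : Set
    _≈_     : Carrier → Carrier → Set
    _≤_     : Carrier → Carrier → Set

record _≅_ (P Q : RawPoset) : Set where
  private
    module P = RawPoset P
    module Q = RawPoset Q
  field
    to       : P.Carrier → Q.Carrier
    from     : Q.Carrier → P.Carrier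
    to-cong  : ∀ {x y} → x P.≈ y → to x Q.≈ to y
    from-cong : ∀ {x y} → x Q.≈ y → from x P.≈ from y
    from-to  : ∀ x → from (to x) P.≈ x
    to-from  : ∀ y → to (from y) Q.≈ y
    to-mono  : ∀ {x y} → x P.≤ y → to x Q.≤ to y
    from-mono : ∀ {x y} → x Q.≤ y → from x P.≤ from y

data Walk {n : ℕ} (E : Fin n → Fin n → Set) (S : Fin n → Set)
          : Fin n → Fin n → Set where
  here : ∀ {i} → Walk E S i i
  step : ∀ {i j k} → E i j → S j → Walk E S j k → Walk E S i k

-- A set partition of Fin n is given by a labelling v : Fin n → Fin n
-- (stored as a vector); the blocks are the fibres of v.
SameBlock : {n : ℕ} → Vec (Fin n) n → Fin n → Fin n → Set
SameBlock v i j = lookup v i ≡ lookup v j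

GConnected : {n : ℕ} → (Fin n → Fin n → Set) → Vec (Fin n) n → Set
GConnected E v = ∀ i j → SameBlock v i j → Walk E (SameBlock v i) i j

BondLattice : (n : ℕ) → (Fin n → Fin n → Set) → RawPoset
BondLattice n E = record
  { Carrier = Σ (Vec (Fin n) n) (GConnected E)
  ; _≈_ = λ π σ → ∀ i j → (SameBlock (proj₁ π) i j → SameBlock (proj₁ σ) i j)
                        × (SameBlock (proj₁ σ) i j → SameBlock (proj₁ π) i j)
  ; _≤_ = λ π σ → ∀ i j → SameBlock (proj₁ π) i j → SameBlock (proj₁ σ) i j
  }

-- The specific graph G on {1,…,16} (vertex k is represented by Fin 16
-- element k-1).

edgesG : List (ℕ × ℕ)
edgesG =
  (1 , 2) ∷ (1 , 3) ∷
  (2 , 3) ∷ (4 , 5) ∷ (6 , 7) ∷ (8 , 9) ∷ (10 , 11) ∷ (12 , 13) ∷ (14 , 15) ∷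
  (2 , 4) ∷ (4 , 6) ∷ (6 , 8) ∷ (8 , 10) ∷ (10 , 12) ∷ (12 , 14) ∷
  (3 , 5) ∷ (5 , 7) ∷ (7 , 9) ∷ (9 , 11) ∷ (11 , 13) ∷ (13 , 15) ∷
  (14 , 16) ∷ (15 , 16) ∷ []

AdjG : Fin 16 → Fin 16 → Set
AdjG i j = ((suc (toℕ i) , suc (toℕ j)) ∈ edgesG)
         ⊎ ((suc (toℕ j) , suc (toℕ i)) ∈ edgesG)

module _ {C : Set} (_≤_ : C → C → Set) where
  Strict : C → C → Set
  Strict x y = x ≤ y × x ≢ y

  Covers : C → C → Set
  Covers x y = Strict x y × (∀ z → ¬ (Strict x z × Strict z y))

  wholePoset : RawPoset
  wholePoset = record { Carrier = C ; _≈_ = _≡_ ; _≤_ = _≤_ }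

  filterPoset : C → RawPoset
  filterPoset p = record
    { Carrier = Σ C (λ q → p ≤ q)
    ; _≈_ = λ a b → proj₁ a ≡ proj₁ b
    ; _≤_ = λ a b → proj₁ a ≤ proj₁ b
    }

  intervalPoset : C → C → RawPoset
  intervalPoset x y = record
    { Carrier = Σ C (λ q → x ≤ q × q ≤ y)
    ; _≈_ = λ a b → proj₁ a ≡ proj₁ b
    ; _≤_ = λ a b → proj₁ a ≤ proj₁ b
    }

record UphoLattice : Set₁ where
  field
    Carrier    : Set
    _≤_        : Carrier → Carrier → Set
    _∨_        : Carrier → Carrier → Carrier
    _∧_        : Carrier → Carrier → Carrier
    isLattice  : IsLattice _≡_ _≤_ _∨_ _∧_
    bot        : Carrier
    bot-min    : ∀ x → bot ≤ x
    rank       : Carrier → ℕ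
    rank-bot   : rank bot ≡ 0
    rank-cover : ∀ {x y} → Covers _≤_ x y → rank y ≡ suc (rank x)
    rank-strict : ∀ {x y} → Strict _≤_ x y → rank x < rank y
    finiteRank : ∀ n → ∃ λ (xs : List Carrier) → ∀ x → rank x ≡ n → x ∈ xs
    nontrivial : ∃₂ λ (x y : Carrier) → x ≢ y
    upho       : ∀ p → filterPoset _≤_ p ≅ wholePoset _≤_

module _ (L : UphoLattice) where
  open UphoLattice L

  Atom : Carrier → Set
  Atom s = Covers _≤_ bot s

  IsJoinOfAtoms : Carrier → Set
  IsJoinOfAtoms t = (∀ s → Atom s → s ≤ t)
                  × (∀ u → (∀ s → Atom s → s ≤ u) → t ≤ u)

  Core : Carrier → RawPoset
  Core t = intervalPoset _≤_ bot t

{-# OPTIONS --safe #-}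
module Submission where

-- Suppose L(G) ≅ [0̂, t] for t the join of the atoms of an upho lattice L.  All atoms of L lie
-- below t, so they are the images of the 23 one-edge partitions; let s be the atom of the rung
-- {4,5}.  As the rung lies in no triangle, the elements of [0̂, t] covering s are the images of
-- the 22 partitions spanned by the rung and one other edge.  Upper homogeneity at s gives
-- ψ : [s, ∞) ≅ L, which exchanges covers of s and atoms.  Every atom other than s lies below a
-- cover of s in [0̂, t], whose ψ-image is an atom and hence below t; so t ≤ ψ⁻¹ t and u = ψ t ≤ t.
-- Through ψ, the atoms below u correspond to the covers of s below t, so the partition
-- corresponding to u contains exactly 22 of the 23 edges.  That is impossible: every edge of G
-- lies on a cycle of length at most 4, so a partition containing all edges but one contains that
-- edge as well.

open import Defs
open import Relation.Nullary using (¬_)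

open import Data.Nat using (ℕ; zero; suc; _<_)
import Data.Nat as ℕ
open import Data.Nat.Properties using (n<1+n)
open import Data.Fin using (Fin; zero; #_; punchIn; punchOut)
open import Data.Fin.Properties
  using (_≟_; all?; any?; ¬∀⟶∃¬; <⇒notInjective; punchIn-injective; punchInᵢ≢i; punchOut-injective)
open import Data.Vec using (Vec; lookup; tabulate; map; _∷_; [])
open import Data.Vec.Properties using (lookup∘tabulate; lookup-map)
open import Data.Product using (Σ; ∃; ∃₂; _×_; _,_; proj₁; proj₂)
open import Data.Product.Properties using (≡-dec)
open import Data.List.Membership.DecPropositional (≡-dec ℕ._≟_ ℕ._≟_) using (_∈?_)
open import Data.Sum as Sum using (_⊎_; inj₁; inj₂; [_,_])
open import Data.Empty using (⊥-elim)
open import Function using (id; _on_)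
open import Function.Definitions using (Injective)
open import Relation.Nullary using (Dec; yes; no; contradiction)
open import Relation.Nullary.Decidable
  using (from-yes; map′; decidable-stable; _×-dec_; _⊎-dec_; _→-dec_; ¬?)
open import Relation.Unary using (Decidable)
open import Relation.Binary.Definitions using (Symmetric)
open import Relation.Binary.PropositionalEquality
  using (_≡_; _≢_; refl; sym; trans; cong; subst; ≢-sym)
open import Relation.Binary.Lattice.Structures using (IsLattice)

-- Counting in Fin

injection-misses-at-most-one : ∀ {n} {P : Fin (suc n) → Set} (ι : Fin n → Fin (suc n))
  → Injective _≡_ _≡_ ι → (∀ x → P (ι x)) → ∀ {g h} → ¬ P g → ¬ P h → g ≡ h
injection-misses-at-most-one {zero} _ _ _ {zero} {zero} _ _ = refl
injection-misses-at-most-one {suc n} {P} ι ι-injective ι∈P {g} {h} ¬Pg ¬Ph with g ≟ h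
... | yes g≡h = g≡h
... | no g≢h  = ⊥-elim (<⇒notInjective (n<1+n n) ι″-injective)
  where
  g∉ι : ∀ x → g ≢ ι x
  g∉ι x g≡ιx = ¬Pg (subst P (sym g≡ιx) (ι∈P x))
  ι′ : Fin (suc n) → Fin (suc n)
  ι′ x = punchOut (g∉ι x)
  h′∉ι′ : ∀ x → punchOut g≢h ≢ ι′ x
  h′∉ι′ x h′≡ι′x = ¬Ph (subst P (sym (punchOut-injective g≢h (g∉ι x) h′≡ι′x)) (ι∈P x))
  ι″ : Fin (suc n) → Fin n
  ι″ x = punchOut (h′∉ι′ x)
  ι″-injective : Injective _≡_ _≡_ ι″
  ι″-injective eq =
    ι-injective (punchOut-injective (g∉ι _) (g∉ι _) (punchOut-injective (h′∉ι′ _) (h′∉ι′ _) eq))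

injection-into-smaller-misses : ∀ {n m} {P : Fin n → Set} → Decidable P
  → (κ : Σ _ P → Fin m) → Injective (_≡_ on proj₁) _≡_ κ → m < n → ∃ λ g → ¬ P g
injection-into-smaller-misses {P = P} P? κ κ-injective m<n with all? P?
... | yes all = ⊥-elim (<⇒notInjective m<n λ {g} {h} → κ-injective {g , all g} {h , all h})
... | no ¬all = ¬∀⟶∃¬ _ P P? ¬all

exactly-one-missing : ∀ {n} {P : Fin (suc n) → Set} → Decidable P → (a : Fin (suc n))
  → (α : Σ _ (_≢ a) → Σ _ P) → Injective (_≡_ on proj₁) (_≡_ on proj₁) α
  → (β : Σ _ P → Σ _ (_≢ a)) → Injective (_≡_ on proj₁) (_≡_ on proj₁) β
  → ∃ λ g → ¬ P g × ∀ h → h ≢ g → P h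
exactly-one-missing {n} {P} P? a α α-injective β β-injective = g , ¬Pg , others
  where
  κ : Σ _ P → Fin n
  κ x = punchOut (≢-sym (proj₂ (β x)))
  κ-injective : Injective (_≡_ on proj₁) _≡_ κ
  κ-injective {x} {y} eq =
    β-injective (punchOut-injective (≢-sym (proj₂ (β x))) (≢-sym (proj₂ (β y))) eq)
  ι : Fin n → Fin (suc n)
  ι x = proj₁ (α (punchIn a x , punchInᵢ≢i a x))
  ι-injective : Injective _≡_ _≡_ ι
  ι-injective eq = punchIn-injective a _ _ (α-injective eq)
  missing = injection-into-smaller-misses P? κ κ-injective (n<1+n n)
  g = proj₁ missing
  ¬Pg = proj₂ missing
  others : ∀ h → h ≢ g → P h
  others h h≢g = decidable-stable (P? h) λ ¬Ph →
    h≢g (injection-misses-at-most-one ι ι-injective (λ x → proj₂ (α _)) ¬Ph ¬Pg)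

-- Set partitions as labellings

Labelling : ℕ → Set
Labelling n = Vec (Fin n) n

module _ {n : ℕ} where

  _⊑_ : Labelling n → Labelling n → Set
  v ⊑ w = ∀ i j → SameBlock v i j → SameBlock w i j

  sameBlock? : ∀ (v : Labelling n) i j → Dec (SameBlock v i j)
  sameBlock? v i j = lookup v i ≟ lookup v j

  _⊑?_ : ∀ (v w : Labelling n) → Dec (v ⊑ w)
  v ⊑? w = all? λ i → all? λ j → sameBlock? v i j →-dec sameBlock? w i j

  discrete : Labelling n
  discrete = tabulate id

  sameBlock-discrete : ∀ {i j} → SameBlock discrete i j → i ≡ j
  sameBlock-discrete {i} {j} i~j =
    trans (sym (lookup∘tabulate id i)) (trans i~j (lookup∘tabulate id j))

  discrete-⊑ : ∀ (v : Labelling n) → discrete ⊑ v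
  discrete-⊑ v i j i~j = cong (lookup v) (sameBlock-discrete i~j)

  relabel : Fin n → Fin n → Fin n → Fin n
  relabel old new l with l ≟ old
  ... | yes _ = new
  ... | no _  = l

  relabel-old : ∀ old new → relabel old new old ≡ new
  relabel-old old new with old ≟ old
  ... | yes _    = refl
  ... | no ¬refl = contradiction refl ¬refl

  relabel-new : ∀ old new → relabel old new new ≡ new
  relabel-new old new with new ≟ old
  ... | yes _ = refl
  ... | no _  = refl

  merge : Labelling n → Fin n → Fin n → Labelling n
  merge v a b = map (relabel (lookup v b) (lookup v a)) v

  module _ (v : Labelling n) (a b : Fin n) where

    merge-⊒ : v ⊑ merge v a b
    merge-⊒ i j i~j =
      trans (lookup-map i _ v) (trans (cong (relabel _ _) i~j) (sym (lookup-map j _ v)))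

    merge-joins : SameBlock (merge v a b) a b
    merge-joins = trans (lookup-map a _ v)
      (trans (relabel-new (lookup v b) (lookup v a))
        (sym (trans (lookup-map b _ v) (relabel-old (lookup v b) (lookup v a)))))

    sameBlock-merge : ∀ {i j} → SameBlock (merge v a b) i j
      → SameBlock v i j ⊎ (SameBlock v i a × SameBlock v b j) ⊎ (SameBlock v i b × SameBlock v a j)
    sameBlock-merge {i} {j} i~j with trans (sym (lookup-map i _ v)) (trans i~j (lookup-map j _ v))
    ... | eq with lookup v i ≟ lookup v b | lookup v j ≟ lookup v b
    ...   | yes i~b | yes j~b = inj₁ (trans i~b (sym j~b))
    ...   | yes i~b | no _    = inj₂ (inj₂ (i~b , eq))
    ...   | no _    | yes j~b = inj₂ (inj₁ (eq , sym j~b))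
    ...   | no _    | no _    = inj₁ eq

-- G-connected partitions

Bond : {n : ℕ} → (Fin n → Fin n → Set) → Set
Bond {n} E = RawPoset.Carrier (BondLattice n E)

module _ {n : ℕ} {E : Fin n → Fin n → Set} where

  walk-map : ∀ {S S′ : Fin n → Set} {i j} → (∀ {k} → S k → S′ k) → Walk E S i j → Walk E S′ i j
  walk-map f here          = here
  walk-map f (step ij s w) = step ij (f s) (walk-map f w)

  _++ʷ_ : ∀ {S i j k} → Walk E S i j → Walk E S j k → Walk E S i k
  here          ++ʷ w′ = w′
  step ij s w ++ʷ w′ = step ij s (w ++ʷ w′)

  discrete-connected : GConnected E discrete
  discrete-connected i j i~j rewrite sameBlock-discrete i~j = here

  private
    walk-in-merge : ∀ v a b {i x j} → SameBlock (merge v a b) i x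
      → Walk E (SameBlock v x) x j → Walk E (SameBlock (merge v a b) i) x j
    walk-in-merge v a b i~x = walk-map λ x~k → trans i~x (merge-⊒ v a b _ _ x~k)

  merge-connected : Symmetric E → ∀ v a b → GConnected E v → E a b → GConnected E (merge v a b)
  merge-connected E-sym v a b conn ab i j i~j with sameBlock-merge v a b i~j
  ... | inj₁ i~ᵛj = walk-map (merge-⊒ v a b i _) (conn i j i~ᵛj)
  ... | inj₂ (inj₁ (i~a , b~j)) =
    walk-in-merge v a b refl (conn i a i~a) ++ʷ step ab i~b (walk-in-merge v a b i~b (conn b j b~j))
    where i~b = trans (merge-⊒ v a b i a i~a) (merge-joins v a b)
  ... | inj₂ (inj₂ (i~b , a~j)) =
    walk-in-merge v a b refl (conn i b i~b) ++ʷ step (E-sym ab) i~a (walk-in-merge v a b i~a (conn a j a~j))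
    where i~a = trans (merge-⊒ v a b i b i~b) (sym (merge-joins v a b))

  walk-exits : ∀ (x y : Labelling n) {i m j} → Walk E (SameBlock x i) m j
    → SameBlock x i m → ¬ SameBlock y m j → ∃₂ λ k l → E k l × SameBlock x k l × ¬ SameBlock y k l
  walk-exits x y here _ m≁j = contradiction refl m≁j
  walk-exits x y {m = m} (step {j = k} mk i~k w) i~m m≁j with sameBlock? y m k
  ... | yes m~k = walk-exits x y w i~k λ k~j → m≁j (trans m~k k~j)
  ... | no m≁k  = m , k , mk , trans (sym i~m) i~k , m≁k

  separated-pair : ∀ (x y : Labelling n) → ¬ x ⊑ y → ∃₂ λ i j → SameBlock x i j × ¬ SameBlock y i j
  separated-pair x y x⋢y with any? (λ i → any? (λ j → sameBlock? x i j ×-dec ¬? (sameBlock? y i j)))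
  ... | yes (i , j , i~j , i≁j) = i , j , i~j , i≁j
  ... | no none = contradiction x⊑y x⋢y
    where
    x⊑y : x ⊑ y
    x⊑y i j i~j = decidable-stable (sameBlock? y i j) λ i≁j → none (i , j , i~j , i≁j)

  crossing-edge : ∀ (X : Bond E) (y : Labelling n) → ¬ proj₁ X ⊑ y
    → ∃₂ λ k l → E k l × SameBlock (proj₁ X) k l × ¬ SameBlock y k l
  crossing-edge (x , conn) y x⋢y with separated-pair x y x⋢y
  ... | i , j , i~j , i≁j = walk-exits x y (conn i j i~j) refl i≁j

  ⊑-by-edges : ∀ (X : Bond E) (y : Labelling n)
    → (∀ {k l} → E k l → SameBlock (proj₁ X) k l → SameBlock y k l) → proj₁ X ⊑ y
  ⊑-by-edges X y edges with proj₁ X ⊑? y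
  ... | yes X⊑y = X⊑y
  ... | no X⋢y with crossing-edge X y X⋢y
  ...   | k , l , kl , k~l , k≁l = contradiction (edges kl k~l) k≁l

-- An isomorphism between a bond lattice and the core of an upho lattice

module CoreIsomorphism {n : ℕ} {E : Fin n → Fin n → Set} (L : UphoLattice) {t : UphoLattice.Carrier L}
                       (Φ : BondLattice n E ≅ Core L t) where
  open UphoLattice L
  open IsLattice isLattice using (reflexive; antisym) renaming (trans to ≤-trans)
  private module Φ = _≅_ Φ

  φ : Bond E → Carrier
  φ X = proj₁ (Φ.to X)

  φ-≤t : ∀ X → φ X ≤ t
  φ-≤t X = proj₂ (proj₂ (Φ.to X))

  φ-mono : ∀ X Y → proj₁ X ⊑ proj₁ Y → φ X ≤ φ Y
  φ-mono X Y = Φ.to-mono {X} {Y}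

  φ-reflects : ∀ X Y → φ X ≤ φ Y → proj₁ X ⊑ proj₁ Y
  φ-reflects X Y φX≤φY i j i~j =
    proj₁ (Φ.from-to Y i j) (Φ.from-mono {Φ.to X} {Φ.to Y} φX≤φY i j (proj₂ (Φ.from-to X i j) i~j))

  φ-injective : ∀ X Y → φ X ≡ φ Y → proj₁ X ⊑ proj₁ Y
  φ-injective X Y eq = φ-reflects X Y (reflexive eq)

  _≟φ_ : ∀ X Y → Dec (φ X ≡ φ Y)
  X ≟φ Y = map′ (λ (X⊑Y , Y⊑X) → Φ.to-cong {X} {Y} λ i j → X⊑Y i j , Y⊑X i j)
                (λ eq → φ-injective X Y eq , φ-injective Y X (sym eq))
                (proj₁ X ⊑? proj₁ Y ×-dec proj₁ Y ⊑? proj₁ X)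

  φ-onto : ∀ {x} → x ≤ t → ∃ λ X → φ X ≡ x
  φ-onto {x} x≤t = Φ.from (x , bot-min x , x≤t) , Φ.to-from (x , bot-min x , x≤t)

  ⊥ᴮ : Bond E
  ⊥ᴮ = discrete , discrete-connected

  φ-⊥ᴮ : φ ⊥ᴮ ≡ bot
  φ-⊥ᴮ with φ-onto (bot-min t)
  ... | B , φB≡bot =
    antisym (≤-trans (φ-mono ⊥ᴮ B (discrete-⊑ (proj₁ B))) (reflexive φB≡bot)) (bot-min _)

  φ-covers : ∀ X Y → proj₁ X ⊑ proj₁ Y → ¬ proj₁ Y ⊑ proj₁ X
    → (∀ Z → proj₁ X ⊑ proj₁ Z → proj₁ Z ⊑ proj₁ Y → proj₁ Y ⊑ proj₁ Z ⊎ proj₁ Z ⊑ proj₁ X)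
    → Covers _≤_ (φ X) (φ Y)
  φ-covers X Y X⊑Y Y⋢X between =
    (φ-mono X Y X⊑Y , λ eq → Y⋢X (φ-injective Y X (sym eq))) , nothing-between
    where
    nothing-between : ∀ z → ¬ (Strict _≤_ (φ X) z × Strict _≤_ z (φ Y))
    nothing-between z ((X≤z , X≢z) , (z≤Y , z≢Y)) with φ-onto (≤-trans z≤Y (φ-≤t Y))
    ... | Z , refl with between Z (φ-reflects X Z X≤z) (φ-reflects Z Y z≤Y)
    ...   | inj₁ Y⊑Z = z≢Y (antisym z≤Y (φ-mono Y Z Y⊑Z))
    ...   | inj₂ Z⊑X = X≢z (antisym X≤z (φ-mono Z X Z⊑X))

  cover-⋢ : ∀ X Y → Covers _≤_ (φ X) (φ Y) → ¬ proj₁ Y ⊑ proj₁ X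
  cover-⋢ X Y ((φX≤φY , φX≢φY) , _) Y⊑X = φX≢φY (antisym φX≤φY (φ-mono Y X Y⊑X))

  cover-squeeze : ∀ X Y W → Covers _≤_ (φ X) (φ Y)
    → proj₁ X ⊑ proj₁ W → ¬ proj₁ W ⊑ proj₁ X → proj₁ W ⊑ proj₁ Y → φ W ≡ φ Y
  cover-squeeze X Y W (_ , nothing-between) X⊑W W⋢X W⊑Y with W ≟φ Y
  ... | yes φW≡φY = φW≡φY
  ... | no φW≢φY  = contradiction
    ((φ-mono X W X⊑W , λ eq → W⋢X (φ-injective W X (sym eq))) , (φ-mono W Y W⊑Y , φW≢φY))
    (nothing-between (φ W))

-- Upper homogeneity at an element s

module FilterIsomorphism (L : UphoLattice) {s : UphoLattice.Carrier L}
                         (ψ : filterPoset (UphoLattice._≤_ L) s ≅ wholePoset (UphoLattice._≤_ L)) where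
  open UphoLattice L
  open IsLattice isLattice using (reflexive; antisym) renaming (refl to ≤-refl; trans to ≤-trans)
  private module ψ = _≅_ ψ

  lower : ∀ {x} → s ≤ x → Carrier
  lower s≤x = ψ.to (_ , s≤x)

  raise : Carrier → Carrier
  raise y = proj₁ (ψ.from y)

  s≤raise : ∀ y → s ≤ raise y
  s≤raise y = proj₂ (ψ.from y)

  raise-lower : ∀ {x} (s≤x : s ≤ x) → raise (lower s≤x) ≡ x
  raise-lower s≤x = ψ.from-to (_ , s≤x)

  lower-raise : ∀ y → lower (s≤raise y) ≡ y
  lower-raise = ψ.to-from

  lower-mono : ∀ {x y} (s≤x : s ≤ x) (s≤y : s ≤ y) → x ≤ y → lower s≤x ≤ lower s≤y
  lower-mono s≤x s≤y = ψ.to-mono {_ , s≤x} {_ , s≤y}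

  raise-mono : ∀ {x y} → x ≤ y → raise x ≤ raise y
  raise-mono {x} {y} = ψ.from-mono {x} {y}

  lower-injective : ∀ {x y} (s≤x : s ≤ x) (s≤y : s ≤ y) → lower s≤x ≡ lower s≤y → x ≡ y
  lower-injective s≤x s≤y eq = trans (sym (raise-lower s≤x)) (trans (cong raise eq) (raise-lower s≤y))

  raise-injective : ∀ {x y} → raise x ≡ raise y → x ≡ y
  raise-injective {x} {y} eq =
    trans (sym (lower-raise x)) (trans (ψ.to-cong {ψ.from x} {ψ.from y} eq) (lower-raise y))

  lower-s : lower ≤-refl ≡ bot
  lower-s = antisym
    (≤-trans (lower-mono ≤-refl (s≤raise bot) (s≤raise bot)) (reflexive (lower-raise bot)))
    (bot-min _)

  raise-bot : raise bot ≡ s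
  raise-bot = trans (cong raise (sym lower-s)) (raise-lower ≤-refl)

  lower-covers : ∀ {x} (s≤x : s ≤ x) → Covers _≤_ s x → Atom L (lower s≤x)
  lower-covers s≤x ((_ , s≢x) , nothing-between) = (bot-min _ , bot≢x) , nothing-between′
    where
    bot≢x : bot ≢ lower s≤x
    bot≢x eq = s≢x (lower-injective ≤-refl s≤x (trans lower-s eq))
    nothing-between′ : ∀ z → ¬ (Strict _≤_ bot z × Strict _≤_ z (lower s≤x))
    nothing-between′ z ((_ , bot≢z) , (z≤x , z≢x)) = nothing-between (raise z)
      ( (s≤raise z , λ eq → bot≢z (raise-injective (trans raise-bot eq)))
      , (≤-trans (raise-mono z≤x) (reflexive (raise-lower s≤x))
        , λ eq → z≢x (raise-injective (trans eq (sym (raise-lower s≤x))))))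

  raise-atom : ∀ {y} → Atom L y → Covers _≤_ s (raise y)
  raise-atom {y} ((_ , bot≢y) , nothing-between) = (s≤raise y , s≢y) , nothing-between′
    where
    s≢y : s ≢ raise y
    s≢y eq = bot≢y (raise-injective (trans raise-bot eq))
    nothing-between′ : ∀ z → ¬ (Strict _≤_ s z × Strict _≤_ z (raise y))
    nothing-between′ z ((s≤z , s≢z) , (z≤y , z≢y)) = nothing-between (lower s≤z)
      ( (bot-min _ , λ eq → s≢z (lower-injective ≤-refl s≤z (trans lower-s eq)))
      , (≤-trans (lower-mono s≤z (s≤raise y) z≤y) (reflexive (lower-raise y))
        , λ eq → z≢y (lower-injective s≤z (s≤raise y) (trans eq (sym (lower-raise y))))))

-- The graph G

Vertex : Set
Vertex = Fin 16

Edge : Set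
Edge = Fin 23

-- the edges of edgesG, with vertex k written as # (k - 1)
ends : Vec (Vertex × Vertex) 23
ends =
  (# 0 , # 1) ∷ (# 0 , # 2) ∷
  (# 1 , # 2) ∷ (# 3 , # 4) ∷ (# 5 , # 6) ∷ (# 7 , # 8) ∷ (# 9 , # 10) ∷ (# 11 , # 12) ∷ (# 13 , # 14) ∷
  (# 1 , # 3) ∷ (# 3 , # 5) ∷ (# 5 , # 7) ∷ (# 7 , # 9) ∷ (# 9 , # 11) ∷ (# 11 , # 13) ∷
  (# 2 , # 4) ∷ (# 4 , # 6) ∷ (# 6 , # 8) ∷ (# 8 , # 10) ∷ (# 10 , # 12) ∷ (# 12 , # 14) ∷
  (# 13 , # 15) ∷ (# 14 , # 15) ∷ []

src dst : Edge → Vertex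
src g = proj₁ (lookup ends g)
dst g = proj₂ (lookup ends g)

adjacent? : ∀ k l → Dec (AdjG k l)
adjacent? k l = (_ ∈? edgesG) ⊎-dec (_ ∈? edgesG)

AdjG-sym : Symmetric AdjG
AdjG-sym (inj₁ kl) = inj₂ kl
AdjG-sym (inj₂ lk) = inj₁ lk

data Joins (g : Edge) : Vertex → Vertex → Set where
  forward  : Joins g (src g) (dst g)
  backward : Joins g (dst g) (src g)

joins? : ∀ g k l → Dec (Joins g k l)
joins? g k l = map′ fromEnds toEnds ((k ≟ src g ×-dec l ≟ dst g) ⊎-dec (k ≟ dst g ×-dec l ≟ src g))
  where
  fromEnds : (k ≡ src g × l ≡ dst g) ⊎ (k ≡ dst g × l ≡ src g) → Joins g k l
  fromEnds (inj₁ (refl , refl)) = forward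
  fromEnds (inj₂ (refl , refl)) = backward
  toEnds : Joins g k l → (k ≡ src g × l ≡ dst g) ⊎ (k ≡ dst g × l ≡ src g)
  toEnds forward  = inj₁ (refl , refl)
  toEnds backward = inj₂ (refl , refl)

InBlock : Labelling 16 → Edge → Set
InBlock v g = SameBlock v (src g) (dst g)

inBlock? : ∀ v g → Dec (InBlock v g)
inBlock? v g = sameBlock? v (src g) (dst g)

module _ (v : Labelling 16) {g : Edge} {k l : Vertex} where

  joins-sameBlock : Joins g k l → InBlock v g → SameBlock v k l
  joins-sameBlock forward  g∈v = g∈v
  joins-sameBlock backward g∈v = sym g∈v

  joins-inBlock : Joins g k l → SameBlock v k l → InBlock v g
  joins-inBlock forward  k~l = k~l
  joins-inBlock backward k~l = sym k~l

abstract
  edge-adjacent : ∀ g → AdjG (src g) (dst g)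
  edge-adjacent = from-yes (all? λ g → adjacent? (src g) (dst g))

  adjacent-edge : ∀ k l → AdjG k l → ∃ λ g → Joins g k l
  adjacent-edge = from-yes (all? λ k → all? λ l → adjacent? k l →-dec any? λ g → joins? g k l)

  joins-unique : ∀ g h → Joins h (src g) (dst g) → g ≡ h
  joins-unique = from-yes (all? λ g → all? λ h → joins? h (src g) (dst g) →-dec g ≟ h)

  no-loops : ∀ g → src g ≢ dst g
  no-loops = from-yes (all? λ g → ¬? (src g ≟ dst g))

edge-inside : ∀ (X : Bond AdjG) y → ¬ proj₁ X ⊑ y → ∃ λ g → InBlock (proj₁ X) g × ¬ InBlock y g
edge-inside X y X⋢y = edge (crossing-edge X y X⋢y)
  where
  edge : (∃₂ λ k l → AdjG k l × SameBlock (proj₁ X) k l × ¬ SameBlock y k l)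
    → ∃ λ g → InBlock (proj₁ X) g × ¬ InBlock y g
  edge (k , l , kl , k~l , k≁l) =
    g , joins-inBlock (proj₁ X) g-kl k~l , λ g∈y → k≁l (joins-sameBlock y g-kl g∈y)
    where
    g = proj₁ (adjacent-edge k l kl)
    g-kl = proj₂ (adjacent-edge k l kl)

⟨_⟩ : Edge → Bond AdjG
⟨ g ⟩ = merge discrete (src g) (dst g)
      , merge-connected AdjG-sym discrete (src g) (dst g) discrete-connected (edge-adjacent g)

-- {4,5}, an edge lying in no triangle
rung : Edge
rung = # 3

⟨rung,_⟩ : Edge → Bond AdjG
⟨rung, f ⟩ = merge (proj₁ ⟨ rung ⟩) (src f) (dst f)
           , merge-connected AdjG-sym (proj₁ ⟨ rung ⟩) (src f) (dst f) (proj₂ ⟨ rung ⟩) (edge-adjacent f)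

Detour : Edge → ℕ → Vertex → Vertex → Set
Detour g zero    i j = i ≡ j
Detour g (suc d) i j = i ≡ j ⊎ ∃ λ h → h ≢ g × ∃ λ k → Joins h i k × Detour g d k j

detour? : ∀ g d i j → Dec (Detour g d i j)
detour? g zero    i j = i ≟ j
detour? g (suc d) i j =
  (i ≟ j) ⊎-dec any? λ h → ¬? (h ≟ g) ×-dec any? λ k → joins? h i k ×-dec detour? g d k j

abstract
  ⟨⟩-edges : ∀ g k l → SameBlock (proj₁ ⟨ g ⟩) k l → AdjG k l → Joins g k l
  ⟨⟩-edges = from-yes (all? λ g → all? λ k → all? λ l →
    sameBlock? (proj₁ ⟨ g ⟩) k l →-dec (adjacent? k l →-dec joins? g k l))

  ⟨rung,⟩-edges : ∀ f k l → SameBlock (proj₁ ⟨rung, f ⟩) k l → AdjG k l → Joins rung k l ⊎ Joins f k l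
  ⟨rung,⟩-edges = from-yes (all? λ f → all? λ k → all? λ l →
    sameBlock? (proj₁ ⟨rung, f ⟩) k l →-dec (adjacent? k l →-dec (joins? rung k l ⊎-dec joins? f k l)))

  short-cycle : ∀ g → Detour g 3 (src g) (dst g)
  short-cycle = from-yes (all? λ g → detour? g 3 (src g) (dst g))

⟨⟩-inBlock : ∀ g → InBlock (proj₁ ⟨ g ⟩) g
⟨⟩-inBlock g = merge-joins discrete (src g) (dst g)

⟨⟩-least : ∀ g y → InBlock y g → proj₁ ⟨ g ⟩ ⊑ y
⟨⟩-least g y g∈y = ⊑-by-edges ⟨ g ⟩ y λ {k} {l} kl k~l → joins-sameBlock y (⟨⟩-edges g k l k~l kl) g∈y

⟨⟩-sole-edge : ∀ g h → InBlock (proj₁ ⟨ h ⟩) g → g ≡ h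
⟨⟩-sole-edge g h g∈h = joins-unique g h (⟨⟩-edges h (src g) (dst g) g∈h (edge-adjacent g))

⟨⟩-injective : ∀ g h → proj₁ ⟨ g ⟩ ⊑ proj₁ ⟨ h ⟩ → g ≡ h
⟨⟩-injective g h g⊑h = ⟨⟩-sole-edge g h (g⊑h (src g) (dst g) (⟨⟩-inBlock g))

⟨⟩-⋢-discrete : ∀ g → ¬ proj₁ ⟨ g ⟩ ⊑ discrete
⟨⟩-⋢-discrete g g⊑0 = no-loops g (sameBlock-discrete (g⊑0 (src g) (dst g) (⟨⟩-inBlock g)))

below-⟨⟩ : ∀ (Z : Bond AdjG) g → proj₁ Z ⊑ proj₁ ⟨ g ⟩ → proj₁ ⟨ g ⟩ ⊑ proj₁ Z ⊎ proj₁ Z ⊑ discrete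
below-⟨⟩ Z g Z⊑g = by-cases (inBlock? (proj₁ Z) g)
  where
  by-cases : Dec (InBlock (proj₁ Z) g) → proj₁ ⟨ g ⟩ ⊑ proj₁ Z ⊎ proj₁ Z ⊑ discrete
  by-cases (yes g∈Z) = inj₁ (⟨⟩-least g (proj₁ Z) g∈Z)
  by-cases (no g∉Z)  = inj₂ (⊑-by-edges Z discrete λ {k} {l} kl k~l →
    contradiction (joins-inBlock (proj₁ Z) (⟨⟩-edges g k l (Z⊑g k l k~l) kl) k~l) g∉Z)

⟨⟩-below : ∀ (X : Bond AdjG) → ¬ proj₁ X ⊑ discrete → ∃ λ g → proj₁ ⟨ g ⟩ ⊑ proj₁ X
⟨⟩-below X X⋢0 = g , ⟨⟩-least g (proj₁ X) g∈X
  where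
  g = proj₁ (edge-inside X discrete X⋢0)
  g∈X = proj₁ (proj₂ (edge-inside X discrete X⋢0))

⟨rung,⟩-inBlock : ∀ f → InBlock (proj₁ ⟨rung, f ⟩) f
⟨rung,⟩-inBlock f = merge-joins (proj₁ ⟨ rung ⟩) (src f) (dst f)

⟨rung⟩-⊑-⟨rung,⟩ : ∀ f → proj₁ ⟨ rung ⟩ ⊑ proj₁ ⟨rung, f ⟩
⟨rung⟩-⊑-⟨rung,⟩ f = merge-⊒ (proj₁ ⟨ rung ⟩) (src f) (dst f)

⟨⟩-⊑-⟨rung,⟩ : ∀ f → proj₁ ⟨ f ⟩ ⊑ proj₁ ⟨rung, f ⟩
⟨⟩-⊑-⟨rung,⟩ f = ⟨⟩-least f (proj₁ ⟨rung, f ⟩) (⟨rung,⟩-inBlock f)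

⟨rung,⟩-least : ∀ f y → InBlock y rung → InBlock y f → proj₁ ⟨rung, f ⟩ ⊑ y
⟨rung,⟩-least f y rung∈y f∈y = ⊑-by-edges ⟨rung, f ⟩ y λ {k} {l} kl k~l →
  [ (λ j → joins-sameBlock y j rung∈y) , (λ j → joins-sameBlock y j f∈y) ] (⟨rung,⟩-edges f k l k~l kl)

⟨rung,⟩-sole-edges : ∀ g f → InBlock (proj₁ ⟨rung, f ⟩) g → g ≡ rung ⊎ g ≡ f
⟨rung,⟩-sole-edges g f g∈f =
  Sum.map (joins-unique g rung) (joins-unique g f) (⟨rung,⟩-edges f (src g) (dst g) g∈f (edge-adjacent g))

⟨rung,⟩-injective : ∀ f f′ → f ≢ rung → proj₁ ⟨rung, f ⟩ ⊑ proj₁ ⟨rung, f′ ⟩ → f ≡ f′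
⟨rung,⟩-injective f f′ f≢rung f⊑f′ with ⟨rung,⟩-sole-edges f f′ (f⊑f′ (src f) (dst f) (⟨rung,⟩-inBlock f))
... | inj₁ f≡rung = contradiction f≡rung f≢rung
... | inj₂ f≡f′   = f≡f′

⟨rung,⟩-⋢-⟨rung⟩ : ∀ f → f ≢ rung → ¬ proj₁ ⟨rung, f ⟩ ⊑ proj₁ ⟨ rung ⟩
⟨rung,⟩-⋢-⟨rung⟩ f f≢rung f⊑rung =
  f≢rung (⟨⟩-sole-edge f rung (f⊑rung (src f) (dst f) (⟨rung,⟩-inBlock f)))

below-⟨rung,⟩ : ∀ (Z : Bond AdjG) f → proj₁ ⟨ rung ⟩ ⊑ proj₁ Z → proj₁ Z ⊑ proj₁ ⟨rung, f ⟩
  → proj₁ ⟨rung, f ⟩ ⊑ proj₁ Z ⊎ proj₁ Z ⊑ proj₁ ⟨ rung ⟩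
below-⟨rung,⟩ Z f rung⊑Z Z⊑f = by-cases (inBlock? (proj₁ Z) f)
  where
  rung∈Z : InBlock (proj₁ Z) rung
  rung∈Z = rung⊑Z (src rung) (dst rung) (⟨⟩-inBlock rung)
  by-cases : Dec (InBlock (proj₁ Z) f) → proj₁ ⟨rung, f ⟩ ⊑ proj₁ Z ⊎ proj₁ Z ⊑ proj₁ ⟨ rung ⟩
  by-cases (yes f∈Z) = inj₁ (⟨rung,⟩-least f (proj₁ Z) rung∈Z f∈Z)
  by-cases (no f∉Z)  = inj₂ (⊑-by-edges Z (proj₁ ⟨ rung ⟩) λ {k} {l} kl k~l →
    [ (λ j → joins-sameBlock (proj₁ ⟨ rung ⟩) j (⟨⟩-inBlock rung))
    , (λ j → contradiction (joins-inBlock (proj₁ Z) j k~l) f∉Z)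
    ] (⟨rung,⟩-edges f k l (Z⊑f k l k~l) kl))

⟨rung,⟩-below : ∀ (Y : Bond AdjG) → proj₁ ⟨ rung ⟩ ⊑ proj₁ Y → ¬ proj₁ Y ⊑ proj₁ ⟨ rung ⟩
  → ∃ λ f → f ≢ rung × proj₁ ⟨rung, f ⟩ ⊑ proj₁ Y
⟨rung,⟩-below Y rung⊑Y Y⋢rung = from-edge (edge-inside Y (proj₁ ⟨ rung ⟩) Y⋢rung)
  where
  from-edge : (∃ λ f → InBlock (proj₁ Y) f × ¬ InBlock (proj₁ ⟨ rung ⟩) f)
    → ∃ λ f → f ≢ rung × proj₁ ⟨rung, f ⟩ ⊑ proj₁ Y
  from-edge (f , f∈Y , f∉rung) =
    f , (λ { refl → f∉rung (⟨⟩-inBlock rung) })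
      , ⟨rung,⟩-least f (proj₁ Y) (rung⊑Y (src rung) (dst rung) (⟨⟩-inBlock rung)) f∈Y

detour-sameBlock : ∀ v g d {i j} → Detour g d i j → (∀ h → h ≢ g → InBlock v h) → SameBlock v i j
detour-sameBlock v g zero    refl                                _      = refl
detour-sameBlock v g (suc d) (inj₁ refl)                         _      = refl
detour-sameBlock v g (suc d) (inj₂ (h , h≢g , k , hik , rest)) others =
  trans (joins-sameBlock v hik (others h h≢g)) (detour-sameBlock v g d rest others)

no-partition-misses-one-edge : ∀ v → ¬ (∃ λ g → ¬ InBlock v g × ∀ h → h ≢ g → InBlock v h)
no-partition-misses-one-edge v (g , g∉v , others) = g∉v (detour-sameBlock v g 3 (short-cycle g) others)

-- L(G) as the core of an upho lattice

module CoreOfUpho (L : UphoLattice) (t : UphoLattice.Carrier L) (t-join : IsJoinOfAtoms L t)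
                  (Φ : BondLattice 16 AdjG ≅ Core L t) where
  open UphoLattice L
  open IsLattice isLattice using (reflexive) renaming (trans to ≤-trans)
  open CoreIsomorphism L Φ

  atom : Edge → Carrier
  atom g = φ ⟨ g ⟩

  s : Carrier
  s = atom rung

  cover : Edge → Carrier
  cover f = φ ⟨rung, f ⟩

  atom-isAtom : ∀ g → Atom L (atom g)
  atom-isAtom g = subst (λ b → Covers _≤_ b (atom g)) φ-⊥ᴮ
    (φ-covers ⊥ᴮ ⟨ g ⟩ (discrete-⊑ (proj₁ ⟨ g ⟩)) (⟨⟩-⋢-discrete g) λ Z _ Z⊑g → below-⟨⟩ Z g Z⊑g)

  atom-injective : ∀ g h → atom g ≡ atom h → g ≡ h
  atom-injective g h eq = ⟨⟩-injective g h (φ-injective ⟨ g ⟩ ⟨ h ⟩ eq)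

  atoms-are-edges : ∀ {x} → Atom L x → ∃ λ g → atom g ≡ x
  atoms-are-edges {x} x-atom = from-preimage (φ-onto (proj₁ t-join x x-atom)) x-atom
    where
    from-preimage : (∃ λ X → φ X ≡ x) → Atom L x → ∃ λ g → atom g ≡ x
    from-preimage (X , refl) X-atom =
      g , cover-squeeze ⊥ᴮ X ⟨ g ⟩ X-covers (discrete-⊑ (proj₁ ⟨ g ⟩)) (⟨⟩-⋢-discrete g) g⊑X
      where
      X-covers : Covers _≤_ (φ ⊥ᴮ) (φ X)
      X-covers = subst (λ b → Covers _≤_ b (φ X)) (sym φ-⊥ᴮ) X-atom
      below = ⟨⟩-below X (cover-⋢ ⊥ᴮ X X-covers)
      g = proj₁ below
      g⊑X = proj₂ below

  s≤cover : ∀ f → s ≤ cover f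
  s≤cover f = φ-mono ⟨ rung ⟩ ⟨rung, f ⟩ (⟨rung⟩-⊑-⟨rung,⟩ f)

  cover-covers : ∀ f → f ≢ rung → Covers _≤_ s (cover f)
  cover-covers f f≢rung = φ-covers ⟨ rung ⟩ ⟨rung, f ⟩ (⟨rung⟩-⊑-⟨rung,⟩ f) (⟨rung,⟩-⋢-⟨rung⟩ f f≢rung)
    λ Z rung⊑Z Z⊑f → below-⟨rung,⟩ Z f rung⊑Z Z⊑f

  cover-injective : ∀ f f′ → f ≢ rung → cover f ≡ cover f′ → f ≡ f′
  cover-injective f f′ f≢rung eq = ⟨rung,⟩-injective f f′ f≢rung (φ-injective ⟨rung, f ⟩ ⟨rung, f′ ⟩ eq)

  covers-of-s : ∀ {y} → Covers _≤_ s y → y ≤ t → ∃ λ f → f ≢ rung × cover f ≡ y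
  covers-of-s {y} y-covers y≤t = from-preimage (φ-onto y≤t) y-covers
    where
    from-preimage : (∃ λ Y → φ Y ≡ y) → Covers _≤_ s y → ∃ λ f → f ≢ rung × cover f ≡ y
    from-preimage (Y , refl) Y-covers = f , f≢rung ,
      cover-squeeze ⟨ rung ⟩ Y ⟨rung, f ⟩ Y-covers (⟨rung⟩-⊑-⟨rung,⟩ f) (⟨rung,⟩-⋢-⟨rung⟩ f f≢rung) f⊑Y
      where
      below = ⟨rung,⟩-below Y (φ-reflects ⟨ rung ⟩ Y (proj₁ (proj₁ Y-covers))) (cover-⋢ ⟨ rung ⟩ Y Y-covers)
      f = proj₁ below
      f≢rung = proj₁ (proj₂ below)
      f⊑Y = proj₂ (proj₂ below)

  open FilterIsomorphism L (upho s)

  s≤t : s ≤ t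
  s≤t = φ-≤t ⟨ rung ⟩

  t≤raise-t : t ≤ raise t
  t≤raise-t = proj₂ t-join (raise t) λ x x-atom → edge-atom≤ (atoms-are-edges x-atom)
    where
    atom≤ : ∀ g → Dec (g ≡ rung) → atom g ≤ raise t
    atom≤ g (yes refl)  = s≤raise t
    atom≤ g (no g≢rung) = ≤-trans (φ-mono ⟨ g ⟩ ⟨rung, g ⟩ (⟨⟩-⊑-⟨rung,⟩ g))
      (≤-trans (reflexive (sym (raise-lower (s≤cover g))))
        (raise-mono (proj₁ t-join _ (lower-covers (s≤cover g) (cover-covers g g≢rung)))))
    edge-atom≤ : ∀ {x} → (∃ λ g → atom g ≡ x) → x ≤ raise t
    edge-atom≤ (g , refl) = atom≤ g (g ≟ rung)

  u : Carrier
  u = lower s≤t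

  u≤t : u ≤ t
  u≤t = ≤-trans (lower-mono s≤t (s≤raise t) t≤raise-t) (reflexive (lower-raise t))

  U : Bond AdjG
  U = proj₁ (φ-onto u≤t)

  φU≡u : φ U ≡ u
  φU≡u = proj₂ (φ-onto u≤t)

  atom≤u⇒inBlock : ∀ g → atom g ≤ u → InBlock (proj₁ U) g
  atom≤u⇒inBlock g atom≤u =
    φ-reflects ⟨ g ⟩ U (≤-trans atom≤u (reflexive (sym φU≡u))) (src g) (dst g) (⟨⟩-inBlock g)

  inBlock⇒atom≤u : ∀ g → InBlock (proj₁ U) g → atom g ≤ u
  inBlock⇒atom≤u g g∈U = ≤-trans (φ-mono ⟨ g ⟩ U (⟨⟩-least g (proj₁ U) g∈U)) (reflexive φU≡u)

  -- Opaque: letting the checker unfold this witness makes the injectivity proof below intractably slow.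
  opaque
    lowered-cover-atom : ∀ f → f ≢ rung → ∃ λ g → atom g ≡ lower (s≤cover f)
    lowered-cover-atom f f≢rung = atoms-are-edges (lower-covers (s≤cover f) (cover-covers f f≢rung))

  edge-of-lowered-cover : Σ Edge (_≢ rung) → Σ Edge (InBlock (proj₁ U))
  edge-of-lowered-cover (f , f≢rung) = g , atom≤u⇒inBlock g
    (≤-trans (reflexive atom-g≡) (lower-mono (s≤cover f) s≤t (φ-≤t ⟨rung, f ⟩)))
    where
    g = proj₁ (lowered-cover-atom f f≢rung)
    atom-g≡ = proj₂ (lowered-cover-atom f f≢rung)

  edge-of-lowered-cover-injective : Injective (_≡_ on proj₁) (_≡_ on proj₁) edge-of-lowered-cover
  edge-of-lowered-cover-injective {f , f≢rung} {f′ , f′≢rung} g≡g′ = cover-injective f f′ f≢rung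
    (lower-injective (s≤cover f) (s≤cover f′)
      (trans (sym (proj₂ (lowered-cover-atom f f≢rung)))
        (trans (cong atom g≡g′) (proj₂ (lowered-cover-atom f′ f′≢rung)))))

  raised-atom-cover : ∀ g → InBlock (proj₁ U) g → ∃ λ f → f ≢ rung × cover f ≡ raise (atom g)
  raised-atom-cover g g∈U = covers-of-s (raise-atom (atom-isAtom g))
    (≤-trans (raise-mono (inBlock⇒atom≤u g g∈U)) (reflexive (raise-lower s≤t)))

  edge-of-raised-atom : Σ Edge (InBlock (proj₁ U)) → Σ Edge (_≢ rung)
  edge-of-raised-atom (g , g∈U) = f , f≢rung
    where
    f = proj₁ (raised-atom-cover g g∈U)
    f≢rung = proj₁ (proj₂ (raised-atom-cover g g∈U))

  edge-of-raised-atom-injective : Injective (_≡_ on proj₁) (_≡_ on proj₁) edge-of-raised-atom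
  edge-of-raised-atom-injective {g , g∈U} {g′ , g′∈U} f≡f′ = atom-injective g g′ (raise-injective
    (trans (sym (proj₂ (proj₂ (raised-atom-cover g g∈U))))
      (trans (cong cover f≡f′) (proj₂ (proj₂ (raised-atom-cover g′ g′∈U))))))

proposition5p8 : (L : UphoLattice) (t : UphoLattice.Carrier L)
    → IsJoinOfAtoms L t → ¬ (BondLattice 16 AdjG ≅ Core L t)
proposition5p8 L t t-join Φ = no-partition-misses-one-edge (proj₁ U)
  (exactly-one-missing (inBlock? (proj₁ U)) rung
    edge-of-lowered-cover edge-of-lowered-cover-injective edge-of-raised-atom edge-of-raised-atom-injective)
  where open CoreOfUpho L t t-join Φ
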